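{- Let $a$ be a positive integer and let $S = \{x_i\}_{i \geq 1}$ and $T = \{y_i\}_{i \geq 1}$ be two strictly increasing sequences of positive integers such that $y_1 = a$, $a$ divides every $y_i$, and $x_i \geq y_i$ for all $i$. Then for all integers $n \geq 1$, \[ \rho(T; n + h_n^{(a)}) \geq \rho(S; n). \]
   Context: For a set $R$ of positive integers, $\rho(R;n)$ denotes the number of partitions of $n$ (non-increasing sequences of positive integers summing to $n$) all of whose parts lie in $R$. For positive integers $a,n$, $h_n^{(a)}$ denotes the least non-negative residue of $-n$ modulo $a$. -}

module Defs where

open import Data.Nat using (ℕ; zero; suc; _+_; _∸_; _≤_; _<_; _⊓_; NonZero)
open import Data.Nat.DivMod using (_%_)
open import Data.List using (List; []; _∷_; [_]; map; concatMap; upTo; filter; length)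
open import Data.List.Relation.Unary.All using (All; all?)
open import Data.Product using (∃)
open import Relation.Binary.PropositionalEquality using (_≡_)
open import Relation.Unary using (Pred; Decidable)
open import Level using (0ℓ)

-- Sequences x : ℕ → ℕ are indexed from 0, i.e. x 0 is the paper's x₁.

StrictlyIncreasing : (ℕ → ℕ) → Set
StrictlyIncreasing x = ∀ i j → i < j → x i < x j

InRange : (ℕ → ℕ) → Pred ℕ 0ℓ
InRange x m = ∃ λ i → x i ≡ m

-- partitionsFuel f m n : all non-increasing lists of positive integers,
-- each ≤ m, summing to n (correct whenever f ≥ n).
partitionsFuel : ℕ → ℕ → ℕ → List (List ℕ)
partitionsFuel _       _ zero    = [ [] ]
partitionsFuel zero    _ (suc n) = []
partitionsFuel (suc f) m (suc n) =
  concatMap (λ k → map (k ∷_) (partitionsFuel f k (suc n ∸ k)))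
            (map suc (upTo (m ⊓ suc n)))

partitions : ℕ → List (List ℕ)
partitions n = partitionsFuel n n n

ρ : (R : Pred ℕ 0ℓ) → Decidable R → ℕ → ℕ
ρ R R? n = length (filter (all? R?) (partitions n))

-- h_n^{(a)}: least non-negative residue of -n modulo a.
h : (a : ℕ) → .{{NonZero a}} → ℕ → ℕ
h a n = (a ∸ n % a) % a

-- Relabel each part x i of a partition of n by y i ≤ x i. The new parts are multiples of a and
-- sum to at most n + h a n, itself a multiple of a, so padding with copies of a = y 0 gives a
-- partition of n + h a n into parts from T. Relabelling back sends the padding to copies of x 0 > 0,
-- whose number is then fixed by the sum n, so the map is injective.
module Submission where

open import Defs
open import Data.Nat using (ℕ; zero; suc; _+_; _*_; _∸_; _⊓_; _≤_; _<_; _≥_; z≤n; s≤s; NonZero; >-nonZero)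
open import Data.Nat.Properties
open import Data.Nat.DivMod using (_%_; _/_; %-distribˡ-+; m%n%n≡m%n; m%n≤n; n%n≡0; m/n*n≡m)
open import Data.Nat.Divisibility using (_∣_; divides; ∣m∣n⇒∣m+n; ∣m+n∣m⇒∣n; m%n≡0⇒n∣m; ∣⇒≤)
open import Data.Nat.ListAction using (sum)
open import Data.Nat.ListAction.Properties using (sum-++)
open import Data.Fin using (Fin)
open import Data.Fin.Properties using (injective⇒≤)
open import Data.List using (List; []; _∷_; map; concatMap; upTo; filter; length; lookup; replicate; _++_)
open import Data.List.Properties using (map-++; map-replicate; ++-cancelʳ; ∷-injectiveʳ)
open import Data.List.Relation.Unary.All as All using (All; []; _∷_; all?)
open import Data.List.Relation.Unary.All.Properties using (++⁺; replicate⁺)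
open import Data.List.Relation.Unary.Any using (here; index)
open import Data.List.Relation.Unary.AllPairs using ([]; _∷_)
open import Data.List.Relation.Unary.Unique.Propositional using (Unique)
import Data.List.Relation.Unary.Unique.Propositional.Properties as Unique
open import Data.List.Membership.Propositional using (_∈_; find; lose)
open import Data.List.Membership.Propositional.Properties
open import Data.List.Membership.Setoid.Properties using (index-injective)
open import Data.Product using (_,_; _×_)
open import Data.Sum using (inj₁; inj₂)
open import Relation.Nullary using (yes; no; ¬_; contradiction)
open import Relation.Unary using (Decidable)
open import Relation.Binary using (tri<; tri≈; tri>)
open import Relation.Binary.PropositionalEquality
  using (_≡_; refl; sym; trans; cong; cong₂; subst; setoid; module ≡-Reasoning)

Unique-lookup-injective : ∀ {A : Set} {xs : List A} → Unique xs →
                          ∀ i j → lookup xs i ≡ lookup xs j → i ≡ j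
Unique-lookup-injective (_  ∷ _) Fin.zero    Fin.zero    _ = refl
Unique-lookup-injective (x≢ ∷ _) Fin.zero    (Fin.suc j) e = contradiction e (All.lookup x≢ (∈-lookup j))
Unique-lookup-injective (x≢ ∷ _) (Fin.suc i) Fin.zero    e = contradiction (sym e) (All.lookup x≢ (∈-lookup i))
Unique-lookup-injective (_  ∷ u) (Fin.suc i) (Fin.suc j) e = cong Fin.suc (Unique-lookup-injective u i j e)

length-≤-by-injection : ∀ {A B : Set} (g : A → B) {xs : List A} {ys : List B} → Unique xs →
                        (∀ {u} → u ∈ xs → g u ∈ ys) →
                        (∀ {u v} → u ∈ xs → v ∈ xs → g u ≡ g v → u ≡ v) →
                        length xs ≤ length ys
length-≤-by-injection {B = B} g {xs} {ys} uniq into inj = injective⇒≤ position-injective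
  where
  position : Fin (length xs) → Fin (length ys)
  position i = index (into (∈-lookup i))

  position-injective : ∀ {i j} → position i ≡ position j → i ≡ j
  position-injective {i} {j} e = Unique-lookup-injective uniq i j
    (inj (∈-lookup i) (∈-lookup j) (index-injective (setoid B) (into (∈-lookup i)) (into (∈-lookup j)) e))

data BoundedPartition : ℕ → List ℕ → Set where
  []   : ∀ {m} → BoundedPartition m []
  cons : ∀ {m k r} → 1 ≤ k → k ≤ m → BoundedPartition k r → BoundedPartition m (k ∷ r)

partitionsFuel-sound : ∀ f m n {p} → p ∈ partitionsFuel f m n → BoundedPartition m p × sum p ≡ n
partitionsFuel-sound f m zero (here refl) = [] , refl
partitionsFuel-sound (suc f) m (suc n) p∈
  with k , k∈ , p∈k ← find (∈-concatMap⁻ (λ k → map (k ∷_) (partitionsFuel f k (suc n ∸ k)))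
                                         {xs = map suc (upTo (m ⊓ suc n))} p∈)
  with j , j∈ , refl ← ∈-map⁻ suc k∈
  with r , r∈ , refl ← ∈-map⁻ (suc j ∷_) p∈k
  with r-partition , r-sum ← partitionsFuel-sound f (suc j) (n ∸ j) r∈ =
    cons (s≤s z≤n) (≤-trans j<m⊓1+n (m⊓n≤m m (suc n))) r-partition ,
    trans (cong (suc j +_) r-sum) (m+[n∸m]≡n (≤-trans j<m⊓1+n (m⊓n≤n m (suc n))))
  where j<m⊓1+n = ∈-upTo⁻ j∈

partitionsFuel-complete : ∀ f m {p} → BoundedPartition m p → sum p ≤ f → p ∈ partitionsFuel f m (sum p)
partitionsFuel-complete f m [] _ = here refl
partitionsFuel-complete (suc f) m {suc j ∷ r} (cons _ k≤m r-partition) (s≤s sum≤f) =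
  ∈-concatMap⁺ (λ k → map (k ∷_) (partitionsFuel f k (suc (j + sum r) ∸ k)))
    (lose (∈-map⁺ suc (∈-upTo⁺ (⊓-glb k≤m (s≤s (m≤m+n j (sum r))))))
          (∈-map⁺ (suc j ∷_) r∈))
  where
  r∈ : r ∈ partitionsFuel f (suc j) (j + sum r ∸ j)
  r∈ = subst (λ s → r ∈ partitionsFuel f (suc j) s) (sym (m+n∸m≡n j (sum r)))
         (partitionsFuel-complete f (suc j) r-partition (≤-trans (m≤n+m (sum r) j) sum≤f))

concatMap-cons-unique : ∀ (F : ℕ → List (List ℕ)) {ks} → Unique ks → (∀ k → Unique (F k)) →
                        Unique (concatMap (λ k → map (k ∷_) (F k)) ks)
concatMap-cons-unique F [] _ = []
concatMap-cons-unique F {k ∷ ks} (k∉ks ∷ uks) uF =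
  Unique.++⁺ (Unique.map⁺ ∷-injectiveʳ (uF k)) (concatMap-cons-unique F uks uF) heads-differ
  where
  heads-differ : ∀ {v} → ¬ (v ∈ map (k ∷_) (F k) × v ∈ concatMap (λ k → map (k ∷_) (F k)) ks)
  heads-differ (v∈k , v∈ks)
    with _ , _ , refl ← ∈-map⁻ (k ∷_) v∈k
    with k′ , k′∈ , v∈k′ ← find (∈-concatMap⁻ (λ k → map (k ∷_) (F k)) {xs = ks} v∈ks)
    with _ , _ , refl ← ∈-map⁻ (k′ ∷_) v∈k′ = All.lookup k∉ks k′∈ refl

partitionsFuel-unique : ∀ f m n → Unique (partitionsFuel f m n)
partitionsFuel-unique f       m zero    = [] ∷ []
partitionsFuel-unique zero    m (suc n) = []
partitionsFuel-unique (suc f) m (suc n) =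
  concatMap-cons-unique (λ k → partitionsFuel f k (suc n ∸ k))
    (Unique.map⁺ suc-injective (Unique.upTo⁺ (m ⊓ suc n))) (λ k → partitionsFuel-unique f k (suc n ∸ k))

sum-replicate : ∀ c v → sum (replicate c v) ≡ c * v
sum-replicate zero    v = refl
sum-replicate (suc c) v = cong (v +_) (sum-replicate c v)

BoundedPartition-replicate : ∀ {m} c {v} → 1 ≤ v → v ≤ m → BoundedPartition m (replicate c v)
BoundedPartition-replicate zero    _   _   = []
BoundedPartition-replicate (suc c) 1≤v v≤m = cons 1≤v v≤m (BoundedPartition-replicate c 1≤v ≤-refl)

BoundedPartition-++-replicate : ∀ {m p} c {v} → BoundedPartition m p → All (v ≤_) p → 1 ≤ v → v ≤ m →
                                BoundedPartition m (p ++ replicate c v)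
BoundedPartition-++-replicate c []                   []           1≤v v≤m = BoundedPartition-replicate c 1≤v v≤m
BoundedPartition-++-replicate c (cons 1≤k k≤m rest) (v≤k ∷ v≤ps) 1≤v _   =
  cons 1≤k k≤m (BoundedPartition-++-replicate c rest v≤ps 1≤v v≤k)

++-replicate-cancelʳ : ∀ {p q : List ℕ} c d {v} → 0 < v → sum p ≡ sum q →
                       p ++ replicate c v ≡ q ++ replicate d v → p ≡ q
++-replicate-cancelʳ {p} {q} c d {v} 0<v sum-p≡sum-q e =
  ++-cancelʳ (replicate d v) p q (subst (λ t → p ++ replicate t v ≡ q ++ replicate d v) c≡d e)
  where
  open ≡-Reasoning
  sums : sum p + c * v ≡ sum q + d * v
  sums = begin
    sum p + c * v                          ≡⟨ cong (sum p +_) (sym (sum-replicate c v)) ⟩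
    sum p + sum (replicate c v)            ≡⟨ sym (sum-++ p _) ⟩
    sum (p ++ replicate c v)               ≡⟨ cong sum e ⟩
    sum (q ++ replicate d v)               ≡⟨ sum-++ q _ ⟩
    sum q + sum (replicate d v)            ≡⟨ cong (sum q +_) (sum-replicate d v) ⟩
    sum q + d * v                          ∎
  c≡d : c ≡ d
  c≡d = *-cancelʳ-≡ c d v {{>-nonZero 0<v}}
          (+-cancelˡ-≡ (sum p) _ _ (trans sums (cong (_+ d * v) (sym sum-p≡sum-q))))

module _ {x : ℕ → ℕ} (x↑ : StrictlyIncreasing x) where

  StrictlyIncreasing⇒injective : ∀ {i j} → x i ≡ x j → i ≡ j
  StrictlyIncreasing⇒injective {i} {j} e with <-cmp i j
  ... | tri< i<j _ _ = contradiction e (<⇒≢ (x↑ i j i<j))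
  ... | tri≈ _ i≡j _ = i≡j
  ... | tri> _ _ j<i = contradiction (sym e) (<⇒≢ (x↑ j i j<i))

  StrictlyIncreasing⇒monotone : ∀ {i j} → i ≤ j → x i ≤ x j
  StrictlyIncreasing⇒monotone {i} {j} i≤j with m≤n⇒m<n∨m≡n i≤j
  ... | inj₁ i<j  = <⇒≤ (x↑ i j i<j)
  ... | inj₂ refl = ≤-refl

  StrictlyIncreasing⇒reflects-≤ : ∀ {i j} → x i ≤ x j → i ≤ j
  StrictlyIncreasing⇒reflects-≤ {i} {j} xi≤xj = ≮⇒≥ (λ j<i → <⇒≱ (x↑ j i j<i) xi≤xj)

∣n+h : ∀ a .{{_ : NonZero a}} n → a ∣ n + h a n
∣n+h a n = m%n≡0⇒n∣m _ a (begin
  (n + (a ∸ r) % a) % a          ≡⟨ %-distribˡ-+ n _ a ⟩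
  (r + (a ∸ r) % a % a) % a      ≡⟨ cong₂ (λ s t → (s + t) % a) (sym (m%n%n≡m%n n a)) (m%n%n≡m%n (a ∸ r) a) ⟩
  (r % a + (a ∸ r) % a) % a      ≡⟨ sym (%-distribˡ-+ r (a ∸ r) a) ⟩
  (r + (a ∸ r)) % a              ≡⟨ cong (_% a) (m+[n∸m]≡n (m%n≤n n a)) ⟩
  a % a                          ≡⟨ n%n≡0 a ⟩
  0                              ∎)
  where
  open ≡-Reasoning
  r = n % a

∣-sum : ∀ {a ps} → All (a ∣_) ps → a ∣ sum ps
∣-sum []             = divides 0 refl
∣-sum (a∣p ∷ a∣ps) = ∣m∣n⇒∣m+n a∣p (∣-sum a∣ps)

relabel : (x y : ℕ → ℕ) → Decidable (InRange x) → ℕ → ℕ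
relabel x y x? v with x? v
... | yes (i , _) = y i
... | no  _       = 0

relabel-at : ∀ {x} (y : ℕ → ℕ) (x? : Decidable (InRange x)) → StrictlyIncreasing x →
             ∀ i → relabel x y x? (x i) ≡ y i
relabel-at {x} y x? x↑ i with x? (x i)
... | yes (j , xj≡xi) = cong y (StrictlyIncreasing⇒injective x↑ xj≡xi)
... | no  ∉range      = contradiction (i , refl) ∉range

module Relabel {x y : ℕ → ℕ} (x↑ : StrictlyIncreasing x) (y↑ : StrictlyIncreasing y)
               (x? : Decidable (InRange x)) where

  ψ : ℕ → ℕ
  ψ = relabel x y x?

  All-map-relabel : ∀ {P : ℕ → Set} {p} → (∀ i → P (y i)) → All (InRange x) p → All P (map ψ p)
  All-map-relabel Py []               = []
  All-map-relabel Py ((i , refl) ∷ ps) rewrite relabel-at y x? x↑ i = Py i ∷ All-map-relabel Py ps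

  sum-map-relabel-≤ : ∀ {p} → (∀ i → y i ≤ x i) → All (InRange x) p → sum (map ψ p) ≤ sum p
  sum-map-relabel-≤ y≤x []                = z≤n
  sum-map-relabel-≤ y≤x ((i , refl) ∷ ps) rewrite relabel-at y x? x↑ i =
    +-mono-≤ (y≤x i) (sum-map-relabel-≤ y≤x ps)

  map-relabel-inverse : ∀ (y? : Decidable (InRange y)) {p} → All (InRange x) p →
                        map (relabel y x y?) (map ψ p) ≡ p
  map-relabel-inverse y? []                = refl
  map-relabel-inverse y? ((i , refl) ∷ ps)
    rewrite relabel-at y x? x↑ i | relabel-at x y? y↑ i = cong (x i ∷_) (map-relabel-inverse y? ps)

  BoundedPartition-relabel : ∀ {m M p} → (∀ i → 0 < y i) → BoundedPartition m p → All (InRange x) p →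
                             (∀ i → x i ≤ m → y i ≤ M) → BoundedPartition M (map ψ p)
  BoundedPartition-relabel y>0 []                  []                _     = []
  BoundedPartition-relabel y>0 (cons _ xi≤m rest) ((i , refl) ∷ ps) bound rewrite relabel-at y x? x↑ i =
    cons (y>0 i) (bound i xi≤m) (BoundedPartition-relabel y>0 rest ps
      (λ j xj≤xi → StrictlyIncreasing⇒monotone y↑ (StrictlyIncreasing⇒reflects-≤ x↑ xj≤xi)))

PartitionInto : (R : ℕ → Set) → ℕ → List ℕ → Set
PartitionInto R n p = BoundedPartition n p × sum p ≡ n × All R p

ρ-mono-by-injection : ∀ {R R′ : ℕ → Set} (R? : Decidable R) (R′? : Decidable R′) {n n′}
                      (g : List ℕ → List ℕ) →
                      (∀ {p} → PartitionInto R n p → PartitionInto R′ n′ (g p)) →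
                      (∀ {p q} → PartitionInto R n p → PartitionInto R n q → g p ≡ g q → p ≡ q) →
                      ρ R R? n ≤ ρ R′ R′? n′
ρ-mono-by-injection R? R′? {n} {n′} g g-into g-injective =
  length-≤-by-injection g (Unique.filter⁺ (all? R?) (partitionsFuel-unique n n n))
    (λ p∈ → member⁺ (g-into (member⁻ p∈)))
    (λ p∈ q∈ → g-injective (member⁻ p∈) (member⁻ q∈))
  where
  member⁻ : ∀ {p} → p ∈ filter (all? R?) (partitions n) → PartitionInto _ n p
  member⁻ p∈ with p∈n , Rp ← ∈-filter⁻ (all? R?) {xs = partitions n} p∈
             with p-bounded , p-sum ← partitionsFuel-sound n n n p∈n = p-bounded , p-sum , Rp

  member⁺ : ∀ {p} → PartitionInto _ n′ p → p ∈ filter (all? R′?) (partitions n′)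
  member⁺ (p-bounded , refl , R′p) =
    ∈-filter⁺ (all? R′?) (partitionsFuel-complete _ _ p-bounded ≤-refl) R′p

module Padding {x y : ℕ → ℕ} (x↑ : StrictlyIncreasing x) (y↑ : StrictlyIncreasing y)
               (S? : Decidable (InRange x)) .{{_ : NonZero (y 0)}} (N : ℕ) where

  open Relabel x↑ y↑ S?

  padding : List ℕ → ℕ
  padding p = (N ∸ sum (map ψ p)) / y 0

  pad : List ℕ → List ℕ
  pad p = map ψ p ++ replicate (padding p) (y 0)

  sum-pad : ∀ {p} → (∀ i → y 0 ∣ y i) → y 0 ∣ N → All (InRange x) p → sum (map ψ p) ≤ N →
            sum (pad p) ≡ N
  sum-pad {p} y0∣y y0∣N Sp s≤N = begin
    sum (map ψ p ++ replicate (padding p) (y 0))  ≡⟨ sum-++ (map ψ p) _ ⟩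
    s + sum (replicate (padding p) (y 0))         ≡⟨ cong (s +_) (sum-replicate (padding p) (y 0)) ⟩
    s + padding p * y 0                           ≡⟨ cong (s +_) (m/n*n≡m y0∣N∸s) ⟩
    s + (N ∸ s)                                   ≡⟨ m+[n∸m]≡n s≤N ⟩
    N                                             ∎
    where
    open ≡-Reasoning
    s = sum (map ψ p)
    y0∣N∸s : y 0 ∣ N ∸ s
    y0∣N∸s = ∣m+n∣m⇒∣n (subst (y 0 ∣_) (sym (m+[n∸m]≡n s≤N)) y0∣N) (∣-sum (All-map-relabel y0∣y Sp))

  pad-PartitionInto : ∀ {n p} → (∀ i → 0 < y i) → (∀ i → y i ≤ x i) → (∀ i → y 0 ∣ y i) →
                      y 0 ∣ N → n ≤ N → y 0 ≤ N →
                      PartitionInto (InRange x) n p → PartitionInto (InRange y) N (pad p)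
  pad-PartitionInto {p = p} y>0 y≤x y0∣y y0∣N n≤N y0≤N (p-bounded , refl , Sp) =
    BoundedPartition-++-replicate (padding p)
      (BoundedPartition-relabel y>0 p-bounded Sp (λ i xi≤n → ≤-trans (y≤x i) (≤-trans xi≤n n≤N)))
      (All-map-relabel (λ i → StrictlyIncreasing⇒monotone y↑ z≤n) Sp) (y>0 0) y0≤N ,
    sum-pad y0∣y y0∣N Sp (≤-trans (sum-map-relabel-≤ y≤x Sp) n≤N) ,
    ++⁺ (All-map-relabel (λ i → i , refl) Sp) (replicate⁺ (padding p) (0 , refl))

  map-relabel-pad : ∀ (T? : Decidable (InRange y)) {p} → All (InRange x) p →
                    map (relabel y x T?) (pad p) ≡ p ++ replicate (padding p) (x 0)
  map-relabel-pad T? {p} Sp = begin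
    map φ (map ψ p ++ replicate (padding p) (y 0))            ≡⟨ map-++ φ (map ψ p) _ ⟩
    map φ (map ψ p) ++ map φ (replicate (padding p) (y 0))    ≡⟨ cong₂ _++_ (map-relabel-inverse T? Sp)
                                                                          (map-replicate φ (padding p) (y 0)) ⟩
    p ++ replicate (padding p) (φ (y 0))                      ≡⟨ cong (λ v → p ++ replicate (padding p) v)
                                                                      (relabel-at x T? y↑ 0) ⟩
    p ++ replicate (padding p) (x 0)                          ∎
    where
    open ≡-Reasoning
    φ = relabel y x T?

  pad-injective : ∀ (T? : Decidable (InRange y)) {p q} → 0 < x 0 → sum p ≡ sum q →
                  All (InRange x) p → All (InRange x) q → pad p ≡ pad q → p ≡ q
  pad-injective T? {p} {q} x0>0 sum-p≡sum-q Sp Sq e =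
    ++-replicate-cancelʳ (padding p) (padding q) x0>0 sum-p≡sum-q (begin
      p ++ replicate (padding p) (x 0)   ≡⟨ sym (map-relabel-pad T? Sp) ⟩
      map (relabel y x T?) (pad p)       ≡⟨ cong (map (relabel y x T?)) e ⟩
      map (relabel y x T?) (pad q)       ≡⟨ map-relabel-pad T? Sq ⟩
      q ++ replicate (padding q) (x 0)   ∎)
    where open ≡-Reasoning

lemma2p2 : (a : ℕ) → .{{_ : NonZero a}} → (x y : ℕ → ℕ)
    → StrictlyIncreasing x → (∀ i → 0 < x i)
    → StrictlyIncreasing y → (∀ i → 0 < y i)
    → y 0 ≡ a → (∀ i → a ∣ y i) → (∀ i → y i ≤ x i)
    → (S? : Decidable (InRange x)) → (T? : Decidable (InRange y))
    → (n : ℕ) → 1 ≤ n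
    → ρ (InRange y) T? (n + h a n) ≥ ρ (InRange x) S? n
lemma2p2 a x y x↑ x>0 y↑ y>0 refl a∣y y≤x S? T? n 1≤n =
  ρ-mono-by-injection S? T? pad
    (pad-PartitionInto y>0 y≤x a∣y a∣N n≤N (∣⇒≤ {{>-nonZero (≤-trans 1≤n n≤N)}} a∣N))
    (λ (_ , p-sum , Sp) (_ , q-sum , Sq) → pad-injective T? (x>0 0) (trans p-sum (sym q-sum)) Sp Sq)
  where
  N = n + h a n
  open Padding x↑ y↑ S? N
  a∣N : a ∣ N
  a∣N = ∣n+h a n
  n≤N : n ≤ N
  n≤N = m≤m+n n (h a n)
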